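{- Let $G$ be a $vgr(n,k,g,\lambda)$-graph with $k\geq 3$, where $g=2h+1$ is odd. Then $$n\ge n(k,g,\lambda)\ge \frac{k(k-1)^h-2}{k-2}+\left\lceil\frac{k(k-1)^h-2\lambda}{k}\right\rceil.$$
   Context: A $vgr(n,k,g,\lambda)$-graph is a $k$-regular graph of girth $g$ on $n$ vertices in which every vertex is contained in exactly $\lambda$ cycles of length $g$. $n(k,g,\lambda)$ denotes the smallest integer $v$ such that a $vgr(v,k,g,\lambda)$-graph exists ($\infty$ if none exists). -}

module Defs where

open import Data.Bool using (Bool; true; false; _∧_; not)
open import Data.Nat using (ℕ; zero; suc; _+_; _*_; _∸_; _^_; _≤_; _<_; _≤ᵇ_)
import Data.Nat as ℕ
open import Data.Fin using (Fin; _≟_)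
open import Data.List using (List; []; _∷_; [_]; length; filterᵇ; concatMap; map; allFin)
open import Data.Vec using (Vec; []; _∷_)
open import Data.Product using (Σ; _×_)
open import Data.Integer using (ℤ; +_; -_; _-_) renaming (_+_ to _+ℤ_)
import Data.Integer.DivMod as ℤDM
open import Relation.Nullary.Decidable using (⌊_⌋)
open import Relation.Binary.PropositionalEquality using (_≡_)

record Graph (n : ℕ) : Set where
  field
    adj   : Fin n → Fin n → Bool
    sym   : ∀ x y → adj x y ≡ adj y x
    irrefl : ∀ x → adj x x ≡ false
open Graph public

degree : ∀ {n} → Graph n → Fin n → ℕ
degree {n} G v = length (filterᵇ (adj G v) (allFin n))

IsRegular : ∀ {n} → Graph n → ℕ → Set
IsRegular {n} G k = ∀ (v : Fin n) → degree G v ≡ k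

elemᵇ : ∀ {n m} → Fin n → Vec (Fin n) m → Bool
elemᵇ x []       = false
elemᵇ x (y ∷ ys) = ⌊ x ≟ y ⌋ Data.Bool.∨ elemᵇ x ys

distinctᵇ : ∀ {n m} → Vec (Fin n) m → Bool
distinctᵇ []       = true
distinctᵇ (x ∷ xs) = not (elemᵇ x xs) ∧ distinctᵇ xs

closedPathᵇ : ∀ {n m} → Graph n → Fin n → Vec (Fin n) m → Bool
closedPathᵇ G first []           = true
closedPathᵇ G first (x ∷ [])     = adj G x first
closedPathᵇ G first (x ∷ y ∷ ys) = adj G x y ∧ closedPathᵇ G first (y ∷ ys)

isCycleᵇ : ∀ {n m} → Graph n → Vec (Fin n) m → Bool
isCycleᵇ G []         = false
isCycleᵇ {m = m} G (x ∷ xs) = (3 ≤ᵇ m) ∧ distinctᵇ (x ∷ xs) ∧ closedPathᵇ G x (x ∷ xs)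

startsAtᵇ : ∀ {n m} → Fin n → Vec (Fin n) m → Bool
startsAtᵇ v []      = false
startsAtᵇ v (x ∷ _) = ⌊ v ≟ x ⌋

allVecs : ∀ n m → List (Vec (Fin n) m)
allVecs n zero    = [ [] ]
allVecs n (suc m) = concatMap (λ x → map (x ∷_) (allVecs n m)) (allFin n)

-- Each m-cycle through v (m ≥ 3) is traced by exactly two such sequences
-- (the two orientations), so this is twice the number of m-cycles through v.
cycleWalksAt : ∀ {n} → Graph n → Fin n → ℕ → ℕ
cycleWalksAt {n} G v m =
  length (filterᵇ (λ xs → startsAtᵇ v xs ∧ isCycleᵇ G xs) (allVecs n m))

HasGirth : ∀ {n} → Graph n → ℕ → Set
HasGirth {n} G g =
  Σ (Vec (Fin n) g) (λ xs → isCycleᵇ G xs ≡ true) ×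
  (∀ m → m < g → ∀ (xs : Vec (Fin n) m) → isCycleᵇ G xs ≡ false)

CyclesPerVertex : ∀ {n} → Graph n → ℕ → ℕ → Set
CyclesPerVertex {n} G g lam = ∀ (v : Fin n) → cycleWalksAt G v g ≡ 2 * lam

IsVGR : ∀ {n} → Graph n → ℕ → ℕ → ℕ → Set
IsVGR G k g lam = IsRegular G k × HasGirth G g × CyclesPerVertex G g lam

IsMinVGROrder : ℕ → ℕ → ℕ → ℕ → Set
IsMinVGROrder k g lam m =
  Σ (Graph m) (λ G → IsVGR G k g lam) ×
  (∀ m' (G : Graph m') → IsVGR G k g lam → m ≤ m')

-- natural-number division (divisor 0 gives 0; only used with k ≥ 3)
divℕ : ℕ → ℕ → ℕ
divℕ a zero    = 0
divℕ a (suc d) = a ℕ./ suc d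

-- ceiling of a / d for an integer a and positive natural d (0 if d = 0)
ceilDiv : ℤ → ℕ → ℤ
ceilDiv a zero    = + 0
ceilDiv a (suc d) = - ((- a) ℤDM./ℕ suc d)

-- (k(k-1)^h - 2)/(k-2) + ⌈(k(k-1)^h - 2 lam)/k⌉
-- (the first quotient is exact for k ≥ 3)
vgrBound : ℕ → ℕ → ℕ → ℤ
vgrBound k h lam =
  + divℕ (k * (k ∸ 1) ^ h ∸ 2) (k ∸ 2)
  +ℤ ceilDiv (+ (k * (k ∸ 1) ^ h) - + (2 * lam)) k

-- Fix a vertex v and write g = 2h + 1. Two distinct non-backtracking walks of length at most h from
-- v cannot end at the same vertex, since together they would close a cycle shorter than g; so the
-- ball of radius h around v has the Moore size B = (k(k-1)^h - 2)/(k - 2). Map the k·B pairs (ball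
-- vertex, edge slot) and the k(k-1)^h non-backtracking walks of length h + 1 from v injectively into
-- the k·n pairs (vertex, edge slot) together with the 2λ oriented g-cycles through v: a pair goes to
-- itself; a walk ending outside the ball goes to its last edge, seen from its end; a walk ending at
-- a ball vertex goes to the g-cycle it closes with the ball walk to that vertex. Hence
-- k·B + k(k-1)^h ≤ k·n + 2λ, which rearranges to the bound. The least order n(k,g,λ) is found by
-- exhaustive search, graphs on a fixed vertex set being finitely many.

module Submission where

open import Defs hiding (sym; irrefl)
open import Data.Bool using (Bool; true; false; _∧_; T)
open import Data.Bool.Properties using (T-≡)
import Data.Bool.Properties as Bool
open import Data.Empty using (⊥; ⊥-elim)
open import Data.Unit using (⊤; tt)
open import Data.Fin using (Fin; zero; suc; _≟_; toℕ; fromℕ<; cast; punchIn; remQuot; combine; splitAt; join)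
open import Data.Fin.Properties
  using (all?; any?; injective⇒≤; +↔⊎; *↔×; combine-remQuot; remQuot-combine; join-splitAt; cast-involutive;
         punchIn-injective; punchInᵢ≢i; toℕ-fromℕ<; toℕ<n)
open import Data.Fin.Subset using (Subset)
open import Data.Fin.Subset.Properties using (anySubset?)
open import Data.Integer using (+_; -_; _-_; _⊖_) renaming (_+_ to _+ℤ_)
import Data.Integer as ℤ
import Data.Integer.Properties as ℤ
open import Data.Integer.DivMod using (_/ℕ_; n<s[n/ℕd]*d)
open import Data.List using (List; []; _∷_; [_]; _++_; _∷ʳ_; _ʳ++_; reverse; length; lookup; filterᵇ; allFin; map)
open import Data.List.Properties
  using (++-assoc; length-++; length-ʳ++; ʳ++-defn; ++-ʳ++; ∷-injectiveˡ; ∷-injectiveʳ; ∷ʳ-injectiveˡ; filter-≐)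
open import Data.List.Membership.Propositional using (_∈_; _∉_)
open import Data.List.Membership.Propositional.Properties
  using (∈-filter⁺; ∈-filter⁻; ∈-lookup; ∈-allFin; ∈-++⁺ʳ; ∈-concat⁺′; ∈-map⁺)
open import Data.List.Relation.Unary.All as All using ([]; _∷_)
open import Data.List.Relation.Unary.All.Properties using (¬Any⇒All¬; ++⁻ˡ)
open import Data.List.Relation.Unary.AllPairs using ([]; _∷_)
open import Data.List.Relation.Unary.Any as Any using (here; there)
open import Data.List.Relation.Unary.Any.Properties using (lookup-index)
open import Data.List.Relation.Unary.First as First using (FirstView)
open import Data.List.Relation.Unary.First.Properties using (¬All⇒First; toView)
open import Data.List.Relation.Unary.Linked using (Linked; []; [-]; _∷_)
open import Data.List.Relation.Unary.Unique.Propositional using (Unique)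
open import Data.List.Relation.Unary.Unique.Propositional.Properties using (filter⁺; allFin⁺)
open import Data.Nat using (ℕ; zero; suc; _+_; _*_; _∸_; _^_; _≤_; _≥_; _<_; z≤n; s≤s; _≤ᵇ_)
open import Data.Nat.Properties
  using (+-comm; +-assoc; +-suc; +-identityʳ; *-identityʳ; *-assoc; *-comm; *-distribˡ-+; suc-injective;
         ≤⇒≤ᵇ; ≤-refl; ≤-reflexive; ≤-trans; <-≤-trans; ≤-pred; n≤1+n; m≤n⇒m≤1+n; 1+n≰n; ≰⇒>; m≤n+m;
         m≤n⇒m<n∨m≡n; +-mono-≤; +-monoʳ-≤; +-cancelˡ-≤; m+[n∸m]≡n; m+n∸n≡m; module ≤-Reasoning)
import Data.Nat.Properties as ℕ
open import Data.Nat.DivMod using (m*n/n≡m)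
open import Data.Nat.Solver using (module +-*-Solver)
open import Data.Product using (Σ; _×_; _,_; proj₁; proj₂; uncurry)
open import Data.Sum using (_⊎_; inj₁; inj₂; [_,_]′)
open import Data.Sum.Properties using (inj₁-injective; inj₂-injective)
open import Data.Sum.Function.Propositional using (_⊎-↔_)
open import Data.Vec using (Vec; []; _∷_; fromList; toList; tabulate)
import Data.Vec as Vec
open import Data.Vec.Properties using (toList∘fromList; lookup∘tabulate)
open import Function.Base using (_∘_)
open import Function.Bundles using (Equivalence; Injection; _↣_; _↔_; mk↣)
open import Function.Consequences.Propositional using (inverseʳ⇒injective; strictlyInverseʳ⇒inverseʳ)
open import Function.Construct.Composition using (_↣-∘_; _↔-∘_)
open import Function.Definitions using (Injective)
open import Function.Properties.Inverse using (↔⇒↣; ↔-sym; ↔-refl)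
open import Relation.Nullary using (¬_; Dec; yes; no; contradiction)
open import Relation.Nullary.Decidable using (T?; ⌊_⌋; ¬?; decidable-stable; _×-dec_; map′)
open import Relation.Binary.Definitions using (DecidableEquality)
open import Relation.Binary.PropositionalEquality hiding ([_])

-- Sphere of radius j + 1 and ball of radius j in the (K + 1)-regular tree.
sphereSize : ℕ → ℕ → ℕ
sphereSize K zero    = suc K
sphereSize K (suc j) = sphereSize K j * K

ballSize : ℕ → ℕ → ℕ
ballSize K zero    = 1
ballSize K (suc j) = ballSize K j + sphereSize K j

sphereSize≡ : ∀ K j → sphereSize K j ≡ suc K * K ^ j
sphereSize≡ K zero    = sym (*-identityʳ (suc K))
sphereSize≡ K (suc j) = begin
  sphereSize K j * K    ≡⟨ cong (_* K) (sphereSize≡ K j) ⟩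
  suc K * K ^ j * K     ≡⟨ *-assoc (suc K) (K ^ j) K ⟩
  suc K * (K ^ j * K)   ≡⟨ cong (suc K *_) (*-comm (K ^ j) K) ⟩
  suc K * K ^ suc j     ∎
  where open ≡-Reasoning

ballSize-closedForm : ∀ K j → suc K * ballSize (2 + K) j + 2 ≡ (3 + K) * (2 + K) ^ j
ballSize-closedForm K zero    = solve 1 (λ x → (con 1 :+ x) :* con 1 :+ con 2 := (con 3 :+ x) :* con 1) refl K
  where open +-*-Solver
ballSize-closedForm K (suc j) = begin
  suc K * (B + S) + 2            ≡⟨ solve 3 (λ x b s → (con 1 :+ x) :* (b :+ s) :+ con 2
                                                    := ((con 1 :+ x) :* b :+ con 2) :+ (con 1 :+ x) :* s) refl K B S ⟩
  (suc K * B + 2) + suc K * S    ≡⟨ cong₂ (λ t s → t + suc K * s) (ballSize-closedForm K j)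
                                                                  (sphereSize≡ (2 + K) j) ⟩
  k * P + suc K * (k * P)        ≡⟨ solve 2 (λ x p → (con 3 :+ x) :* p :+ (con 1 :+ x) :* ((con 3 :+ x) :* p)
                                                  := (con 3 :+ x) :* ((con 2 :+ x) :* p)) refl K P ⟩
  k * (2 + K) ^ suc j            ∎
  where
  open ≡-Reasoning
  open +-*-Solver
  k = 3 + K
  B = ballSize (2 + K) j
  S = sphereSize (2 + K) j
  P = (2 + K) ^ j

ceilDiv-≤ : ∀ k a d → a ℤ.≤ + (suc k * d) → ceilDiv a (suc k) ℤ.≤ + d
ceilDiv-≤ k a d a≤kd = subst (- q ℤ.≤_) (ℤ.neg-involutive (+ d)) (ℤ.neg-mono-≤ -d≤q)
  where
  q = (- a) /ℕ suc k
  -d*k<[1+q]*k : - + d ℤ.* + suc k ℤ.< ℤ.suc q ℤ.* + suc k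
  -d*k<[1+q]*k = begin-strict
    - + d ℤ.* + suc k    ≡⟨ ℤ.neg-distribˡ-* (+ d) (+ suc k) ⟨
    - (+ d ℤ.* + suc k)  ≡⟨ cong -_ (trans (cong +_ (*-comm (suc k) d)) (ℤ.pos-* d (suc k))) ⟨
    - + (suc k * d)      ≤⟨ ℤ.neg-mono-≤ a≤kd ⟩
    - a                  <⟨ n<s[n/ℕd]*d (- a) (suc k) ⟩
    ℤ.suc q ℤ.* + suc k  ∎
    where open ℤ.≤-Reasoning
  -d≤q : - + d ℤ.≤ q
  -d≤q = subst (- + d ℤ.≤_) (ℤ.pred-suc q)
               (ℤ.i<j⇒i≤pred[j] (ℤ.*-cancelʳ-<-nonNeg {j = ℤ.suc q} (+ suc k) -d*k<[1+q]*k))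

vgrBound-≤ : ∀ K h lam n →
             (3 + K) * ballSize (2 + K) h + (3 + K) * (2 + K) ^ h ≤ (3 + K) * n + 2 * lam →
             ballSize (2 + K) h ≤ n → vgrBound (3 + K) h lam ℤ.≤ + n
vgrBound-≤ K h lam n count B≤n = bound
  where
  k B X Y d : ℕ
  k = 3 + K
  B = ballSize (2 + K) h
  X = k * (2 + K) ^ h
  Y = 2 * lam
  d = n ∸ B

  quotient≡B : divℕ (X ∸ 2) (suc K) ≡ B
  quotient≡B = begin
    divℕ (X ∸ 2) (suc K)              ≡⟨ cong (λ x → divℕ (x ∸ 2) (suc K)) (ballSize-closedForm K h) ⟨
    divℕ (suc K * B + 2 ∸ 2) (suc K)  ≡⟨ cong (λ x → divℕ x (suc K)) (m+n∸n≡m (suc K * B) 2) ⟩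
    divℕ (suc K * B) (suc K)          ≡⟨ cong (λ x → divℕ x (suc K)) (*-comm (suc K) B) ⟩
    divℕ (B * suc K) (suc K)          ≡⟨ m*n/n≡m B (suc K) ⟩
    B                                 ∎
    where open ≡-Reasoning

  X≤kd+Y : X ≤ k * d + Y
  X≤kd+Y = +-cancelˡ-≤ (k * B) X (k * d + Y) (begin
    k * B + X            ≤⟨ count ⟩
    k * n + Y            ≡⟨ cong (λ m → k * m + Y) (m+[n∸m]≡n B≤n) ⟨
    k * (B + d) + Y      ≡⟨ cong (_+ Y) (*-distribˡ-+ k B d) ⟩
    k * B + k * d + Y    ≡⟨ +-assoc (k * B) (k * d) Y ⟩
    k * B + (k * d + Y)  ∎)
    where open ≤-Reasoning

  numerator≤ : + X - + Y ℤ.≤ + (k * d)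
  numerator≤ = begin
    + X - + Y          ≡⟨ ℤ.m-n≡m⊖n X Y ⟩
    X ⊖ Y              ≤⟨ ℤ.⊖-monoˡ-≤ Y X≤kd+Y ⟩
    (k * d + Y) ⊖ Y    ≡⟨ ℤ.⊖-≥ (m≤n+m Y (k * d)) ⟩
    + (k * d + Y ∸ Y)  ≡⟨ cong +_ (m+n∸n≡m (k * d) Y) ⟩
    + (k * d)          ∎
    where open ℤ.≤-Reasoning

  bound : vgrBound k h lam ℤ.≤ + n
  bound = begin
    + divℕ (X ∸ 2) (suc K) +ℤ ceilDiv (+ X - + Y) k  ≡⟨ cong (λ b → + b +ℤ ceilDiv (+ X - + Y) k) quotient≡B ⟩
    + B +ℤ ceilDiv (+ X - + Y) k                     ≤⟨ ℤ.+-monoʳ-≤ (+ B) (ceilDiv-≤ (2 + K) _ d numerator≤) ⟩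
    + B +ℤ + d                                       ≡⟨ ℤ.pos-+ B d ⟨
    + (B + d)                                        ≡⟨ cong +_ (m+[n∸m]≡n B≤n) ⟩
    + n                                              ∎
    where open ℤ.≤-Reasoning

module _ {A : Set} where

  length-∷ʳ : ∀ (xs : List A) {x} → length (xs ∷ʳ x) ≡ suc (length xs)
  length-∷ʳ xs = trans (length-++ xs) (+-comm (length xs) 1)

  length-<-++-∷ : ∀ (xs : List A) {y ys} → length xs < length (xs ++ y ∷ ys)
  length-<-++-∷ []       = s≤s z≤n
  length-<-++-∷ (_ ∷ xs) = s≤s (length-<-++-∷ xs)

  ∈-∷ʳ : ∀ (xs : List A) {x} → x ∈ xs ∷ʳ x
  ∈-∷ʳ xs = ∈-++⁺ʳ xs (here refl)

  ʳ++-++ : ∀ (xs ys zs : List A) → xs ʳ++ (ys ++ zs) ≡ (xs ʳ++ ys) ++ zs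
  ʳ++-++ xs ys zs = begin
    xs ʳ++ (ys ++ zs)         ≡⟨ ʳ++-defn xs ⟩
    reverse xs ++ ys ++ zs    ≡⟨ ++-assoc (reverse xs) ys zs ⟨
    (reverse xs ++ ys) ++ zs  ≡⟨ cong (_++ zs) (ʳ++-defn xs) ⟨
    (xs ʳ++ ys) ++ zs         ∎
    where open ≡-Reasoning

  ʳ++-injective : ∀ (xs xs′ : List A) {ys ys′} → length xs ≡ length xs′ → xs ʳ++ ys ≡ xs′ ʳ++ ys′ →
                  xs ≡ xs′ × ys ≡ ys′
  ʳ++-injective []       []         _   eq = refl , eq
  ʳ++-injective (x ∷ xs) (x′ ∷ xs′) len eq with ʳ++-injective xs xs′ (suc-injective len) eq
  ... | xs≡ , x∷ys≡ = cong₂ _∷_ (∷-injectiveˡ x∷ys≡) xs≡ , ∷-injectiveʳ x∷ys≡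

  Linked-++⁻ˡ : ∀ {R : A → A → Set} xs {ys} → Linked R (xs ++ ys) → Linked R xs
  Linked-++⁻ˡ []           _        = []
  Linked-++⁻ˡ (x ∷ [])     _        = [-]
  Linked-++⁻ˡ (x ∷ y ∷ xs) (xy ∷ w) = xy ∷ Linked-++⁻ˡ (y ∷ xs) w

  Unique-++⁻ˡ : ∀ (xs : List A) {ys} → Unique (xs ++ ys) → Unique xs
  Unique-++⁻ˡ []       _          = []
  Unique-++⁻ˡ (x ∷ xs) (x∉ ∷ xs!) = ++⁻ˡ xs x∉ ∷ Unique-++⁻ˡ xs xs!

  Unique-ʳ++⁻ʳ : ∀ (xs : List A) {ys} → Unique (xs ʳ++ ys) → Unique ys
  Unique-ʳ++⁻ʳ []       xs!ys = xs!ys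
  Unique-ʳ++⁻ʳ (x ∷ xs) xs!ys with Unique-ʳ++⁻ʳ xs xs!ys
  ... | _ ∷ ys! = ys!

  Unique-ʳ++-disjoint : ∀ (xs : List A) {ys z} → Unique (xs ʳ++ ys) → z ∈ xs → z ∉ ys
  Unique-ʳ++-disjoint (x ∷ xs) xs!ys (here refl)  z∈ys with Unique-ʳ++⁻ʳ xs xs!ys
  ... | x∉ys ∷ _ = All.lookup x∉ys z∈ys refl
  Unique-ʳ++-disjoint (x ∷ xs) xs!ys (there z∈xs) z∈ys = Unique-ʳ++-disjoint xs xs!ys z∈xs (there z∈ys)

  Unique⇒lookup-injective : ∀ {xs : List A} → Unique xs → Injective _≡_ _≡_ (lookup xs)
  Unique⇒lookup-injective (x∉ ∷ _)   {zero}  {zero}  _  = refl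
  Unique⇒lookup-injective (x∉ ∷ _)   {zero}  {suc j} eq = contradiction eq (All.lookup x∉ (∈-lookup j))
  Unique⇒lookup-injective (x∉ ∷ _)   {suc i} {zero}  eq = contradiction (sym eq) (All.lookup x∉ (∈-lookup i))
  Unique⇒lookup-injective (_  ∷ xs!) {suc i} {suc j} eq = cong suc (Unique⇒lookup-injective xs! eq)

  firstOccurrence : DecidableEquality A → ∀ {x xs} → x ∈ xs → FirstView (x ≢_) (x ≡_) xs
  firstOccurrence _≟_ {x} x∈xs =
    toView (¬All⇒First (λ y → ¬? (x ≟ y)) (λ {y} → decidable-stable (x ≟ y))
                       (λ x≢xs → All.lookup x≢xs x∈xs refl))

  toVec : ∀ {m} (xs : List A) → length xs ≡ m → Vec A m
  toVec xs refl = fromList xs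

  toList-toVec : ∀ {m} xs (len : length xs ≡ m) → toList (toVec xs len) ≡ xs
  toList-toVec xs refl = toList∘fromList xs

  toVec-resp : ∀ (p : ∀ {m} → Vec A m → Bool) {m} xs (len : length xs ≡ m) → p (toVec xs len) ≡ p (fromList xs)
  toVec-resp p xs refl = refl

retraction⇒injective : ∀ {A B : Set} {f : A → B} (g : B → A) → (∀ x → g (f x) ≡ x) → Injective _≡_ _≡_ f
retraction⇒injective {f = f} g gf = inverseʳ⇒injective f (strictlyInverseʳ⇒inverseʳ {f⁻¹ = g} f gf)

remQuot-injective : ∀ m {k} → Injective _≡_ _≡_ (remQuot {m} k)
remQuot-injective m {k} = retraction⇒injective (uncurry combine) (combine-remQuot {m} k)

splitAt-injective : ∀ m {k} → Injective _≡_ _≡_ (splitAt m {k})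
splitAt-injective m {k} = retraction⇒injective (join m k) (join-splitAt m k)

↣⇒≤ : ∀ {a b c d e} → ((Fin a × Fin b) ⊎ Fin c) ↣ ((Fin a × Fin d) ⊎ Fin e) → a * b + c ≤ a * d + e
↣⇒≤ f = injective⇒≤ (Injection.injective (↔⇒↣ (↔-sym asFin) ↣-∘ (f ↣-∘ ↔⇒↣ asFin)))
  where
  asFin : ∀ {a b c} → Fin (a * b + c) ↔ ((Fin a × Fin b) ⊎ Fin c)
  asFin = (*↔× ⊎-↔ ↔-refl) ↔-∘ +↔⊎

∈-allVecs : ∀ {n} m (xs : Vec (Fin n) m) → xs ∈ allVecs n m
∈-allVecs     zero    []       = here refl
∈-allVecs {n} (suc m) (x ∷ xs) =
  ∈-concat⁺′ (∈-map⁺ (x ∷_) (∈-allVecs m xs)) (∈-map⁺ (λ y → map (y ∷_) (allVecs n m)) (∈-allFin x))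

module Walks {n : ℕ} (G : Graph n) where

  Adj : Fin n → Fin n → Set
  Adj x y = adj G x y ≡ true

  Adj-sym : ∀ {x y} → Adj x y → Adj y x
  Adj-sym {x} {y} xy = trans (Graph.sym G y x) xy

  Adj⇒≢ : ∀ {x y} → Adj x y → x ≢ y
  Adj⇒≢ {x} xx refl with trans (sym xx) (Graph.irrefl G x)
  ... | ()

  data NBWalk : List (Fin n) → Set where
    point : ∀ x → NBWalk [ x ]
    edge  : ∀ {x y} → Adj x y → NBWalk (x ∷ y ∷ [])
    cons  : ∀ {x y z zs} → Adj x y → x ≢ z → NBWalk (y ∷ z ∷ zs) → NBWalk (x ∷ y ∷ z ∷ zs)

  NBWalk⇒Linked : ∀ {xs} → NBWalk xs → Linked Adj xs
  NBWalk⇒Linked (point x)     = [-]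
  NBWalk⇒Linked (edge xy)     = xy ∷ [-]
  NBWalk⇒Linked (cons xy _ w) = xy ∷ NBWalk⇒Linked w

  NBWalk-head : ∀ {x y ys} → NBWalk (x ∷ y ∷ ys) → Adj x y
  NBWalk-head (edge xy)     = xy
  NBWalk-head (cons xy _ _) = xy

  NBWalk-tail : ∀ {x y ys} → NBWalk (x ∷ y ∷ ys) → NBWalk (y ∷ ys)
  NBWalk-tail (edge _)     = point _
  NBWalk-tail (cons _ _ w) = w

  NBWalk-∷ʳ-tail : ∀ {x y} b → NBWalk ((x ∷ b) ∷ʳ y) → NBWalk (b ∷ʳ y)
  NBWalk-∷ʳ-tail []      _ = point _
  NBWalk-∷ʳ-tail (_ ∷ _) w = NBWalk-tail w

  NBWalk-++⁻ˡ : ∀ x xs {ys} → NBWalk (x ∷ xs ++ ys) → NBWalk (x ∷ xs)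
  NBWalk-++⁻ˡ x []           _               = point x
  NBWalk-++⁻ˡ x (y ∷ [])     w               = edge (NBWalk-head w)
  NBWalk-++⁻ˡ x (y ∷ z ∷ xs) (cons xy x≢z w) = cons xy x≢z (NBWalk-++⁻ˡ y (z ∷ xs) w)

  HeadsDiffer : List (Fin n) → List (Fin n) → Set
  HeadsDiffer (x ∷ _) (y ∷ _) = x ≢ y
  HeadsDiffer _       _       = ⊤

  NBWalk-ʳ++ : ∀ {x} xs ys → NBWalk (x ∷ xs) → NBWalk (x ∷ ys) → HeadsDiffer xs ys → NBWalk (xs ʳ++ (x ∷ ys))
  NBWalk-ʳ++     []       ys _ w′ _  = w′
  NBWalk-ʳ++ {x} (y ∷ xs) ys w w′ y≢ = NBWalk-ʳ++ xs (x ∷ ys) (NBWalk-tail w) (prepend ys w′ y≢) (differ xs w)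
    where
    yx : Adj y x
    yx = Adj-sym (NBWalk-head w)
    prepend : ∀ ys → NBWalk (x ∷ ys) → HeadsDiffer (y ∷ xs) ys → NBWalk (y ∷ x ∷ ys)
    prepend []      _  _   = edge yx
    prepend (_ ∷ _) w′ y≢z = cons yx y≢z w′
    differ : ∀ xs → NBWalk (x ∷ y ∷ xs) → HeadsDiffer xs (x ∷ ys)
    differ []      _              = tt
    differ (_ ∷ _) (cons _ x≢z _) = x≢z ∘ sym

  lastOf : Fin n → List (Fin n) → Fin n
  lastOf x []       = x
  lastOf x (y ∷ ys) = lastOf y ys

  lastOf-∈ : ∀ x ys → lastOf x ys ∈ x ∷ ys
  lastOf-∈ x []       = here refl
  lastOf-∈ x (y ∷ ys) = there (lastOf-∈ y ys)

  lastOf-∷ʳ : ∀ x b {y} → lastOf x (b ∷ʳ y) ≡ y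
  lastOf-∷ʳ x []      = refl
  lastOf-∷ʳ x (y ∷ b) = lastOf-∷ʳ y b

  IsCycle : List (Fin n) → Set
  IsCycle []       = ⊥
  IsCycle (x ∷ xs) = 3 ≤ length (x ∷ xs) × Unique (x ∷ xs) × Linked Adj ((x ∷ xs) ∷ʳ x)

  private
    elemᵇ-∉ : ∀ {x : Fin n} xs → x ∉ xs → elemᵇ x (fromList xs) ≡ false
    elemᵇ-∉     []       _  = refl
    elemᵇ-∉ {x} (y ∷ ys) x∉ with x ≟ y
    ... | yes refl = contradiction (here refl) x∉
    ... | no  _    = elemᵇ-∉ ys (x∉ ∘ there)

    distinctᵇ-Unique : ∀ (xs : List (Fin n)) → Unique xs → distinctᵇ (fromList xs) ≡ true
    distinctᵇ-Unique []       _          = refl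
    distinctᵇ-Unique (x ∷ xs) (x∉ ∷ xs!)
      rewrite elemᵇ-∉ xs (λ x∈xs → All.lookup x∉ x∈xs refl) | distinctᵇ-Unique xs xs! = refl

    closedPathᵇ-Linked : ∀ f x xs → Linked Adj ((x ∷ xs) ∷ʳ f) → closedPathᵇ G f (fromList (x ∷ xs)) ≡ true
    closedPathᵇ-Linked f x []       (xf ∷ _) = xf
    closedPathᵇ-Linked f x (y ∷ ys) (xy ∷ w) rewrite xy = closedPathᵇ-Linked f y ys w

  IsCycle⇒isCycleᵇ : ∀ xs → IsCycle xs → isCycleᵇ G (fromList xs) ≡ true
  IsCycle⇒isCycleᵇ (x ∷ xs) (3≤ , xs! , closed) rewrite Equivalence.to T-≡ (≤⇒≤ᵇ 3≤) =
    trans (cong (_∧ closedPathᵇ G x (fromList (x ∷ xs))) (distinctᵇ-Unique (x ∷ xs) xs!))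
          (closedPathᵇ-Linked x x xs closed)

  module NoCycleBelow (g : ℕ) (noShortCycle : ∀ m → m < g → ∀ (xs : Vec (Fin n) m) → isCycleᵇ G xs ≡ false) where

    IsCycle⇒¬length< : ∀ xs → IsCycle xs → ¬ length xs < g
    IsCycle⇒¬length< xs cycle <g
      with trans (sym (IsCycle⇒isCycleᵇ xs cycle)) (noShortCycle (length xs) <g (fromList xs))
    ... | ()

    -- A repeated vertex on a short non-backtracking walk would close a cycle shorter than g.
    NBWalk⇒Unique : ∀ {xs} → NBWalk xs → length xs ≤ g → Unique xs
    NBWalk⇒Unique (point x) _ = [] ∷ []
    NBWalk⇒Unique (edge xy) _ = (Adj⇒≢ xy ∷ []) ∷ [] ∷ []
    NBWalk⇒Unique {x ∷ y ∷ z ∷ zs} w@(cons xy x≢z w′) ≤g = ¬Any⇒All¬ _ x∉ ∷ yzzs!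
      where
      yzzs! : Unique (y ∷ z ∷ zs)
      yzzs! = NBWalk⇒Unique w′ (≤-trans (n≤1+n _) ≤g)
      x∉ : x ∉ y ∷ z ∷ zs
      x∉ (here x≡y)           = Adj⇒≢ xy x≡y
      x∉ (there (here x≡z))   = x≢z x≡z
      x∉ (there (there x∈zs)) with firstOccurrence _≟_ x∈zs
      ... | First._++_∷_ {pre} pre≢ refl post =
        IsCycle⇒¬length< cycle (s≤s (s≤s (s≤s z≤n)) , cycle! , closed) shorter
        where
        cycle = x ∷ y ∷ z ∷ pre
        cycle! : Unique cycle
        cycle! = ¬Any⇒All¬ _ (λ { (here x≡y)            → Adj⇒≢ xy x≡y
                                ; (there (here x≡z))    → x≢z x≡z
                                ; (there (there x∈pre)) → All.lookup pre≢ x∈pre refl })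
                 ∷ Unique-++⁻ˡ (y ∷ z ∷ pre) yzzs!
        closed : Linked Adj (cycle ∷ʳ x)
        closed = Linked-++⁻ˡ (cycle ∷ʳ x) (subst (Linked Adj) (sym (++-assoc cycle [ x ] post)) (NBWalk⇒Linked w))
        shorter : length cycle < g
        shorter = <-≤-trans (s≤s (s≤s (s≤s (length-<-++-∷ pre)))) ≤g

    -- If P ≢ Q, gluing the two walks where they first diverge gives a short non-backtracking walk
    -- visiting their common end twice.
    NBWalk-lastOf-injective : ∀ e P Q → NBWalk (e ∷ P) → NBWalk (e ∷ Q) → length P + length Q < g →
                              lastOf e P ≡ lastOf e Q → P ≡ Q
    NBWalk-lastOf-injective e []      []      _  _  _  _     = refl
    NBWalk-lastOf-injective e []      (q ∷ Q) _  wQ <g last≡ with NBWalk⇒Unique wQ <g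
    ... | e∉ ∷ _ = ⊥-elim (All.lookup e∉ (subst (_∈ q ∷ Q) (sym last≡) (lastOf-∈ q Q)) refl)
    NBWalk-lastOf-injective e (p ∷ P) []      wP _  <g last≡
      with NBWalk⇒Unique wP (subst (λ m → suc m ≤ g) (+-identityʳ _) <g)
    ... | e∉ ∷ _ = ⊥-elim (All.lookup e∉ (subst (_∈ p ∷ P) last≡ (lastOf-∈ p P)) refl)
    NBWalk-lastOf-injective e (p ∷ P) (q ∷ Q) wP wQ <g last≡ with p ≟ q
    ... | yes refl = cong (p ∷_) (NBWalk-lastOf-injective p P Q (NBWalk-tail wP) (NBWalk-tail wQ) <g′ last≡)
      where
      <g′ : length P + length Q < g
      <g′ = ≤-trans (s≤s (+-monoʳ-≤ (length P) (n≤1+n (length Q)))) (≤-trans (n≤1+n _) <g)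
    ... | no p≢q = ⊥-elim (Unique-ʳ++-disjoint (p ∷ P) glued! (lastOf-∈ p P) end∈)
      where
      glued! : Unique ((p ∷ P) ʳ++ (e ∷ q ∷ Q))
      glued! = NBWalk⇒Unique (NBWalk-ʳ++ (p ∷ P) (q ∷ Q) wP wQ p≢q)
        (subst (_≤ g) (sym (trans (length-ʳ++ (p ∷ P)) (+-suc (suc (length P)) (suc (length Q))))) <g)
      end∈ : lastOf p P ∈ e ∷ q ∷ Q
      end∈ = subst (_∈ e ∷ q ∷ Q) (sym last≡) (there (lastOf-∈ q Q))

module Neighbours {n : ℕ} (G : Graph n) (K : ℕ) (regular : IsRegular G (suc K)) where

  open Walks G using (Adj)

  neighbours : Fin n → List (Fin n)
  neighbours u = filterᵇ (adj G u) (allFin n)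

  nbr : Fin n → Fin (suc K) → Fin n
  nbr u i = lookup (neighbours u) (cast (sym (regular u)) i)

  nbr-adj : ∀ u i → Adj u (nbr u i)
  nbr-adj u i =
    Equivalence.to T-≡ (proj₂ (∈-filter⁻ (T? ∘ adj G u) {xs = allFin n} (∈-lookup (cast (sym (regular u)) i))))

  nbr-injective : ∀ u → Injective _≡_ _≡_ (nbr u)
  nbr-injective u = retraction⇒injective (cast (regular u)) (cast-involutive (regular u) (sym (regular u)))
                  ∘ Unique⇒lookup-injective (filter⁺ (T? ∘ adj G u) (allFin⁺ n))

  nbr-surjective : ∀ {u w} → Adj u w → Σ (Fin (suc K)) λ i → nbr u i ≡ w
  nbr-surjective {u} {w} uw =
    cast (regular u) (Any.index w∈) ,
    trans (cong (lookup (neighbours u)) (cast-involutive (sym (regular u)) (regular u) _)) (sym (lookup-index w∈))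
    where
    w∈ : w ∈ neighbours u
    w∈ = ∈-filter⁺ (T? ∘ adj G u) (∈-allFin w) (Equivalence.from T-≡ uw)

  -- A junk value unless w is a neighbour of u.
  indexOf : Fin n → Fin n → Fin (suc K)
  indexOf u w with any? (λ i → nbr u i ≟ w)
  ... | yes (i , _) = i
  ... | no _        = zero

  nbr-indexOf : ∀ {u w} → Adj u w → nbr u (indexOf u w) ≡ w
  nbr-indexOf {u} {w} uw with any? (λ i → nbr u i ≟ w)
  ... | yes (_ , eq) = eq
  ... | no ∄i        = contradiction (nbr-surjective uw) ∄i

  otherNbr : Fin n → Fin n → Fin K → Fin n
  otherNbr u w r = nbr u (punchIn (indexOf u w) r)

  otherNbr-≢ : ∀ {u w} r → Adj u w → otherNbr u w r ≢ w
  otherNbr-≢ {u} {w} r uw eq = punchInᵢ≢i (indexOf u w) r (nbr-injective u (trans eq (sym (nbr-indexOf uw))))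

  otherNbr-injective : ∀ u w → Injective _≡_ _≡_ (otherNbr u w)
  otherNbr-injective u w = punchIn-injective (indexOf u w) _ _ ∘ nbr-injective u

module Counting {n : ℕ} (G : Graph n) (K : ℕ) (regular : IsRegular G (suc K)) (h′ : ℕ)
  (noShortCycle : ∀ m → m < 2 * suc h′ + 1 → ∀ (xs : Vec (Fin n) m) → isCycleᵇ G xs ≡ false)
  (v : Fin n) where

  h g : ℕ
  h = suc h′
  g = 2 * h + 1

  open Walks G
  open NoCycleBelow g noShortCycle
  open Neighbours G K regular

  g≡ : g ≡ suc (h + h)
  g≡ = trans (+-comm (2 * h) 1) (cong (λ m → suc (h + m)) (+-identityʳ h))

  +<g : ∀ {a b} → a ≤ h → b ≤ h → a + b < g
  +<g {a} {b} a≤h b≤h = subst (a + b <_) (sym g≡) (s≤s (+-mono-≤ a≤h b≤h))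

  -- A list b encodes the walk b ∷ʳ v from v, read backwards; tip b is its far end.
  tip : List (Fin n) → Fin n
  tip []      = v
  tip (x ∷ _) = x

  tip-adj : ∀ {e} b → NBWalk ((e ∷ b) ∷ʳ v) → Adj e (tip b)
  tip-adj []      w = NBWalk-head w
  tip-adj (_ ∷ _) w = NBWalk-head w

  ¬returns : ∀ b → NBWalk ((v ∷ b) ∷ʳ v) → 2 + length b ≤ g → ⊥
  ¬returns b w ≤g with NBWalk⇒Unique w (subst (_≤ g) (sym (cong suc (length-∷ʳ b))) ≤g)
  ... | v∉ ∷ _ = All.lookup v∉ (∈-∷ʳ b) refl

  tip-injective : ∀ b b′ → NBWalk (b ∷ʳ v) → NBWalk (b′ ∷ʳ v) → length b + length b′ < g →
                  tip b ≡ tip b′ → b ≡ b′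
  tip-injective []      []        _ _  _  _    = refl
  tip-injective []      (_ ∷ b′)  _ w′ <g refl = ⊥-elim (¬returns b′ w′ <g)
  tip-injective (_ ∷ b) []        w _  <g refl =
    ⊥-elim (¬returns b w (subst (λ m → suc m ≤ g) (+-identityʳ _) <g))
  tip-injective (u ∷ b) (.u ∷ b′) w w′ <g refl =
    cong (u ∷_) (∷ʳ-injectiveˡ b b′ (NBWalk-lastOf-injective u (b ∷ʳ v) (b′ ∷ʳ v) w w′ <g′ last≡))
    where
    <g′ : length (b ∷ʳ v) + length (b′ ∷ʳ v) < g
    <g′ = subst₂ (λ l l′ → suc (l + l′) ≤ g) (sym (length-∷ʳ b)) (sym (length-∷ʳ b′)) <g
    last≡ : lastOf u (b ∷ʳ v) ≡ lastOf u (b′ ∷ʳ v)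
    last≡ = trans (lastOf-∷ʳ u b) (sym (lastOf-∷ʳ u b′))

  parent : ∀ j → Fin (sphereSize K (suc j)) → Fin (sphereSize K j)
  parent j c = proj₁ (remQuot {sphereSize K j} K c)

  branch : ∀ j → Fin (sphereSize K (suc j)) → Fin K
  branch j c = proj₂ (remQuot {sphereSize K j} K c)

  sphereTip  : (j : ℕ) → Fin (sphereSize K j) → Fin n
  sphereRest : (j : ℕ) → Fin (sphereSize K j) → List (Fin n)
  sphereTip zero    i = nbr v i
  sphereTip (suc j) c = otherNbr (sphereTip j (parent j c)) (tip (sphereRest j (parent j c))) (branch j c)
  sphereRest zero    _ = []
  sphereRest (suc j) c = sphereTip j (parent j c) ∷ sphereRest j (parent j c)

  sphereWalk : (j : ℕ) → Fin (sphereSize K j) → List (Fin n)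
  sphereWalk j c = sphereTip j c ∷ sphereRest j c

  length-sphereRest : ∀ j c → length (sphereRest j c) ≡ j
  length-sphereRest zero    _ = refl
  length-sphereRest (suc j) c = cong suc (length-sphereRest j (parent j c))

  sphereWalk-NBWalk : ∀ j c → NBWalk (sphereWalk j c ∷ʳ v)
  sphereWalk-NBWalk zero    i = edge (Adj-sym (nbr-adj v i))
  sphereWalk-NBWalk (suc j) c = extend (sphereRest j (parent j c)) (sphereWalk-NBWalk j (parent j c))
    where
    extend : ∀ {u} b → NBWalk ((u ∷ b) ∷ʳ v) → NBWalk ((otherNbr u (tip b) (branch j c) ∷ u ∷ b) ∷ʳ v)
    extend []      w = cons (Adj-sym (nbr-adj _ _)) (otherNbr-≢ (branch j c) (NBWalk-head w)) w
    extend (_ ∷ _) w = cons (Adj-sym (nbr-adj _ _)) (otherNbr-≢ (branch j c) (NBWalk-head w)) w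

  sphereWalk-injective : ∀ j → Injective _≡_ _≡_ (sphereWalk j)
  sphereWalk-injective zero    eq = nbr-injective v (∷-injectiveˡ eq)
  sphereWalk-injective (suc j) {c} {c′} eq = remQuot-injective (sphereSize K j) (cong₂ _,_ parent≡ branch≡)
    where
    parent≡ : parent j c ≡ parent j c′
    parent≡ = sphereWalk-injective j (∷-injectiveʳ eq)
    branch≡ : branch j c ≡ branch j c′
    branch≡ = otherNbr-injective _ _ (trans (∷-injectiveˡ eq)
      (cong (λ a → otherNbr (sphereTip j a) (tip (sphereRest j a)) (branch j c′)) (sym parent≡)))

  sphereWalk-tips-injective : ∀ c c′ → sphereTip h c ≡ sphereTip h c′ →
                              tip (sphereRest h c) ≡ tip (sphereRest h c′) → c ≡ c′
  sphereWalk-tips-injective c c′ tip≡ prev≡ = sphereWalk-injective h (cong₂ _∷_ tip≡ rest≡)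
    where
    rest-NBWalk : ∀ c → NBWalk (sphereRest h c ∷ʳ v)
    rest-NBWalk c = NBWalk-∷ʳ-tail (sphereRest h c) (sphereWalk-NBWalk h c)
    rest≡ : sphereRest h c ≡ sphereRest h c′
    rest≡ = tip-injective _ _ (rest-NBWalk c) (rest-NBWalk c′)
              (+<g (≤-reflexive (length-sphereRest h c)) (≤-reflexive (length-sphereRest h c′))) prev≡

  ballWalk : (j : ℕ) → Fin (ballSize K j) → List (Fin n)
  ballWalk zero    _ = []
  ballWalk (suc j) x = [ ballWalk j , sphereWalk j ]′ (splitAt (ballSize K j) x)

  length-ballWalk : ∀ j x → length (ballWalk j x) ≤ j
  length-ballWalk zero    _ = z≤n
  length-ballWalk (suc j) x with splitAt (ballSize K j) x
  ... | inj₁ y = ≤-trans (length-ballWalk j y) (n≤1+n j)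
  ... | inj₂ c = s≤s (≤-reflexive (length-sphereRest j c))

  ballWalk-NBWalk : ∀ j x → NBWalk (ballWalk j x ∷ʳ v)
  ballWalk-NBWalk zero    _ = point v
  ballWalk-NBWalk (suc j) x with splitAt (ballSize K j) x
  ... | inj₁ y = ballWalk-NBWalk j y
  ... | inj₂ c = sphereWalk-NBWalk j c

  ballWalk-injective : ∀ j → Injective _≡_ _≡_ (ballWalk j)
  ballWalk-injective zero    {zero} {zero} _ = refl
  ballWalk-injective (suc j) eq = splitAt-injective (ballSize K j) (layer-injective _ _ eq)
    where
    inner≢outer : ∀ y c → ballWalk j y ≢ sphereWalk j c
    inner≢outer y c eq =
      1+n≰n (subst (_≤ j) (cong suc (length-sphereRest j c)) (subst (λ b → length b ≤ j) eq (length-ballWalk j y)))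
    layer-injective : ∀ s s′ → [ ballWalk j , sphereWalk j ]′ s ≡ [ ballWalk j , sphereWalk j ]′ s′ → s ≡ s′
    layer-injective (inj₁ y) (inj₁ y′) eq = cong inj₁ (ballWalk-injective j eq)
    layer-injective (inj₂ c) (inj₂ c′) eq = cong inj₂ (sphereWalk-injective j eq)
    layer-injective (inj₁ y) (inj₂ c)  eq = contradiction eq (inner≢outer y c)
    layer-injective (inj₂ c) (inj₁ y)  eq = contradiction (sym eq) (inner≢outer y c)

  ballVertex : Fin (ballSize K h) → Fin n
  ballVertex x = tip (ballWalk h x)

  ballVertex-injective : Injective _≡_ _≡_ ballVertex
  ballVertex-injective {x} {x′} = ballWalk-injective h
    ∘ tip-injective _ _ (ballWalk-NBWalk h x) (ballWalk-NBWalk h x′) (+<g (length-ballWalk h x) (length-ballWalk h x′))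

  -- The two walks from v to e form a closed non-backtracking walk of length at most g, which
  -- therefore has no repeated vertex other than v and length exactly g.
  closeCycle : ∀ e b p → NBWalk ((e ∷ b) ∷ʳ v) → length b ≡ h →
               NBWalk (p ∷ʳ v) → length p ≤ h → tip p ≡ e →
               IsCycle (v ∷ b ʳ++ p) × length (v ∷ b ʳ++ p) ≡ g
  closeCycle e b []      walk |b| _ _ refl =
    ⊥-elim (¬returns b walk (subst (λ m → 2 + m ≤ g) (sym |b|)
                                   (subst (2 + h ≤_) (sym g≡) (s≤s (s≤s (m≤n+m h h′))))))
  closeCycle e []      (_ ∷ _)  _    ()
  closeCycle e (w ∷ b) (.e ∷ p) walk |b| walk′ |p| refl = (3≤ , cycle! , NBWalk⇒Linked closed) , length-cycle
    where
    cycle = v ∷ (w ∷ b) ʳ++ (e ∷ p)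

    heads≢ : w ≢ tip p
    heads≢ w≡ = 1+n≰n (subst (λ l → suc l ≤ h) (trans (cong length (sym w∷b≡p)) |b|) |p|)
      where
      w∷b≡p : w ∷ b ≡ p
      w∷b≡p = tip-injective (w ∷ b) p (NBWalk-tail walk) (NBWalk-∷ʳ-tail p walk′)
                (+<g (≤-reflexive |b|) (≤-trans (n≤1+n _) |p|)) w≡

    glued : NBWalk (((w ∷ b) ∷ʳ v) ʳ++ (e ∷ p ∷ʳ v))
    glued = NBWalk-ʳ++ ((w ∷ b) ∷ʳ v) (p ∷ʳ v) walk walk′ (differ p heads≢)
      where
      differ : ∀ p → w ≢ tip p → HeadsDiffer ((w ∷ b) ∷ʳ v) (p ∷ʳ v)
      differ []      w≢ = w≢
      differ (_ ∷ _) w≢ = w≢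

    |p|≡h′ : length p ≡ h′
    |p|≡h′ with m≤n⇒m<n∨m≡n (≤-pred |p|)
    ... | inj₂ eq  = eq
    ... | inj₁ <h′ = ⊥-elim (Unique-ʳ++-disjoint ((w ∷ b) ∷ʳ v) glued! (∈-∷ʳ (w ∷ b)) (there (∈-∷ʳ p)))
      where
      length-glued : length (((w ∷ b) ∷ʳ v) ʳ++ (e ∷ p ∷ʳ v)) ≡ suc h + suc (suc (length p))
      length-glued = trans (length-ʳ++ ((w ∷ b) ∷ʳ v))
        (cong₂ (λ l l′ → l + suc l′) (trans (length-∷ʳ (w ∷ b)) (cong suc |b|)) (length-∷ʳ p))
      glued! : Unique (((w ∷ b) ∷ʳ v) ʳ++ (e ∷ p ∷ʳ v))
      glued! = NBWalk⇒Unique glued (subst (_≤ g) (sym length-glued)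
        (subst (suc h + suc (suc (length p)) ≤_) (sym g≡) (s≤s (+-monoʳ-≤ h (s≤s <h′)))))

    closed : NBWalk (cycle ∷ʳ v)
    closed = subst NBWalk (trans (++-ʳ++ (w ∷ b)) (cong (v ∷_) (ʳ++-++ (w ∷ b) (e ∷ p) [ v ]))) glued

    length-cycle : length cycle ≡ g
    length-cycle = trans (cong suc (length-ʳ++ (w ∷ b)))
                         (trans (cong₂ (λ l l′ → suc (l + suc l′)) |b| |p|≡h′) (sym g≡))

    3≤ : 3 ≤ length cycle
    3≤ = subst (3 ≤_) (sym (trans length-cycle g≡)) (s≤s (s≤s (≤-trans (s≤s z≤n) (m≤n+m (suc h′) h′))))

    cycle! : Unique cycle
    cycle! = NBWalk⇒Unique (NBWalk-++⁻ˡ v ((w ∷ b) ʳ++ (e ∷ p)) closed) (≤-reflexive length-cycle)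

  IsCycleWalkAt : ∀ {m} → Vec (Fin n) m → Bool
  IsCycleWalkAt xs = startsAtᵇ v xs ∧ isCycleᵇ G xs

  cycleWalks : List (Vec (Fin n) g)
  cycleWalks = filterᵇ IsCycleWalkAt (allVecs n g)

  closingCycle : ∀ c x → ballVertex x ≡ sphereTip h c →
                 Σ (List (Fin n)) λ l → IsCycle (v ∷ l) × length (v ∷ l) ≡ g
  closingCycle c x eq = sphereRest h c ʳ++ ballWalk h x , closeCycle (sphereTip h c) (sphereRest h c) (ballWalk h x)
    (sphereWalk-NBWalk h c) (length-sphereRest h c) (ballWalk-NBWalk h x) (length-ballWalk h x) eq

  closingCycleWalk : ∀ c x → ballVertex x ≡ sphereTip h c → Vec (Fin n) g
  closingCycleWalk c x eq = toVec (v ∷ proj₁ cc) (proj₂ (proj₂ cc))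
    where cc = closingCycle c x eq

  toList-closingCycleWalk : ∀ c x eq → toList (closingCycleWalk c x eq) ≡ v ∷ sphereRest h c ʳ++ ballWalk h x
  toList-closingCycleWalk c x eq = toList-toVec _ (proj₂ (proj₂ (closingCycle c x eq)))

  closingCycleWalk-∈ : ∀ c x eq → closingCycleWalk c x eq ∈ cycleWalks
  closingCycleWalk-∈ c x eq = ∈-filter⁺ (T? ∘ IsCycleWalkAt) (∈-allVecs g _) (Equivalence.from T-≡ (begin
    IsCycleWalkAt (toVec (v ∷ l) len)          ≡⟨ toVec-resp IsCycleWalkAt (v ∷ l) len ⟩
    ⌊ v ≟ v ⌋ ∧ isCycleᵇ G (fromList (v ∷ l))  ≡⟨ cong₂ _∧_ (cong ⌊_⌋ (≡-≟-identity _≟_ {v} refl))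
                                                          (IsCycle⇒isCycleᵇ (v ∷ l) cycle) ⟩
    true                                       ∎))
    where
    open ≡-Reasoning
    l = proj₁ (closingCycle c x eq)
    cycle = proj₁ (proj₂ (closingCycle c x eq))
    len = proj₂ (proj₂ (closingCycle c x eq))

  InBall : Fin n → Set
  InBall u = Σ (Fin (ballSize K h)) λ x → ballVertex x ≡ u

  encodeBoundary : ∀ c → Dec (InBall (sphereTip h c)) → (Fin (suc K) × Fin n) ⊎ Fin (cycleWalksAt G v g)
  encodeBoundary c (yes (x , eq)) = inj₂ (Any.index (closingCycleWalk-∈ c x eq))
  encodeBoundary c (no _)         = inj₁ (indexOf (sphereTip h c) (tip (sphereRest h c)) , sphereTip h c)

  encode : (Fin (suc K) × Fin (ballSize K h)) ⊎ Fin (sphereSize K h) →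
           (Fin (suc K) × Fin n) ⊎ Fin (cycleWalksAt G v g)
  encode (inj₁ (i , x)) = inj₁ (i , ballVertex x)
  encode (inj₂ c)       = encodeBoundary c (any? λ x → ballVertex x ≟ sphereTip h c)

  encodeBoundary-injective : ∀ c c′ d d′ → encodeBoundary c d ≡ encodeBoundary c′ d′ → c ≡ c′
  encodeBoundary-injective c c′ (yes (x , eq)) (yes (x′ , eq′)) e≡ =
    sphereWalk-tips-injective c c′ (trans (sym eq) (trans (cong tip (proj₂ halves≡)) eq′))
                                   (cong tip (proj₁ halves≡))
    where
    walk≡ : closingCycleWalk c x eq ≡ closingCycleWalk c′ x′ eq′
    walk≡ = trans (lookup-index (closingCycleWalk-∈ c x eq))
              (trans (cong (lookup cycleWalks) (inj₂-injective e≡))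
                     (sym (lookup-index (closingCycleWalk-∈ c′ x′ eq′))))
    halves≡ : sphereRest h c ≡ sphereRest h c′ × ballWalk h x ≡ ballWalk h x′
    halves≡ = ʳ++-injective _ _ (trans (length-sphereRest h c) (sym (length-sphereRest h c′))) (∷-injectiveʳ
      (trans (sym (toList-closingCycleWalk c x eq)) (trans (cong toList walk≡) (toList-closingCycleWalk c′ x′ eq′))))
  encodeBoundary-injective c c′ (no _) (no _) e≡ = sphereWalk-tips-injective c c′ tip≡ prev≡
    where
    tip≡ : sphereTip h c ≡ sphereTip h c′
    tip≡ = cong proj₂ (inj₁-injective e≡)
    prev-adj : ∀ c → Adj (sphereTip h c) (tip (sphereRest h c))
    prev-adj c = tip-adj (sphereRest h c) (sphereWalk-NBWalk h c)
    prev≡ : tip (sphereRest h c) ≡ tip (sphereRest h c′)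
    prev≡ = trans (sym (nbr-indexOf (prev-adj c)))
              (trans (cong₂ nbr tip≡ (cong proj₁ (inj₁-injective e≡))) (nbr-indexOf (prev-adj c′)))
  encodeBoundary-injective c c′ (yes _) (no _)  ()
  encodeBoundary-injective c c′ (no _)  (yes _) ()

  ball≢boundary : ∀ i x c d → inj₁ (i , ballVertex x) ≢ encodeBoundary c d
  ball≢boundary i x c (yes _)    ()
  ball≢boundary i x c (no ∉ball) e≡ = ∉ball (x , cong proj₂ (inj₁-injective e≡))

  encode-injective : Injective _≡_ _≡_ encode
  encode-injective {inj₁ (i , x)} {inj₁ (i′ , x′)} e≡ =
    cong inj₁ (cong₂ _,_ (cong proj₁ (inj₁-injective e≡))
                         (ballVertex-injective (cong proj₂ (inj₁-injective e≡))))
  encode-injective {inj₁ (i , x)} {inj₂ c}         e≡ = contradiction e≡ (ball≢boundary i x c _)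
  encode-injective {inj₂ c}       {inj₁ (i , x)}   e≡ = contradiction (sym e≡) (ball≢boundary i x c _)
  encode-injective {inj₂ c}       {inj₂ c′}        e≡ = cong inj₂ (encodeBoundary-injective c c′ _ _ e≡)

  ball+sphere≤ : suc K * ballSize K h + sphereSize K h ≤ suc K * n + cycleWalksAt G v g
  ball+sphere≤ = ↣⇒≤ (mk↣ encode-injective)

  ballSize≤n : ballSize K h ≤ n
  ballSize≤n = injective⇒≤ ballVertex-injective

vgr⇒vgrBound≤order : ∀ {n} k h lam (G : Graph n) → k ≥ 3 → IsVGR G k (2 * h + 1) lam →
                     vgrBound k h lam ℤ.≤ + n
vgr⇒vgrBound≤order zero                _        _   _ ()             _
vgr⇒vgrBound≤order (suc zero)          _        _   _ (s≤s ())       _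
vgr⇒vgrBound≤order (suc (suc zero))    _        _   _ (s≤s (s≤s ())) _
vgr⇒vgrBound≤order (suc (suc (suc K))) zero     _   _ _ (_ , (((_ ∷ []) , ()) , _) , _)
vgr⇒vgrBound≤order {n} (suc (suc (suc K))) (suc h′) lam G _
                   (regular , (((v ∷ _) , _) , noShortCycle) , perVertex) =
  vgrBound-≤ K (suc h′) lam n count ballSize≤n
  where
  open Counting G (2 + K) regular h′ noShortCycle v
  count : (3 + K) * ballSize (2 + K) h + (3 + K) * (2 + K) ^ h ≤ (3 + K) * n + 2 * lam
  count = subst₂ (λ s c → (3 + K) * ballSize (2 + K) h + s ≤ (3 + K) * n + c)
                 (sphereSize≡ (2 + K) h) (perVertex v) ball+sphere≤

any-Vec? : ∀ {n} m (p : Vec (Fin n) m → Bool) → Dec (Σ (Vec (Fin n) m) λ xs → p xs ≡ true)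
any-Vec? {n} m p = map′ Any.satisfied (λ (xs , pxs) → Any.map (λ { refl → pxs }) (∈-allVecs m xs))
                        (Any.any? (λ xs → p xs Bool.≟ true) (allVecs n m))

all-Vec? : ∀ {n} m (p : Vec (Fin n) m → Bool) → Dec (∀ xs → p xs ≡ false)
all-Vec? {n} m p = map′ (λ all xs → All.lookup all (∈-allVecs m xs)) (λ all → All.tabulate λ {xs} _ → all xs)
                        (All.all? (λ xs → p xs Bool.≟ false) (allVecs n m))

all<? : ∀ {Q : ℕ → Set} → (∀ m → Dec (Q m)) → ∀ g → Dec (∀ m → m < g → Q m)
all<? {Q} Q? g = map′ (λ all m m<g → subst Q (toℕ-fromℕ< m<g) (all (fromℕ< m<g)))
                      (λ all i → all (toℕ i) (toℕ<n i))
                      (all? (Q? ∘ toℕ))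

IsVGR? : ∀ {n} (G : Graph n) k g lam → Dec (IsVGR G k g lam)
IsVGR? G k g lam =
  all? (λ v → degree G v ℕ.≟ k) ×-dec
  ((any-Vec? g (isCycleᵇ G) ×-dec all<? (λ m → all-Vec? m (isCycleᵇ G)) g) ×-dec
  all? (λ v → cycleWalksAt G v g ℕ.≟ 2 * lam))

SameAdjacency : ∀ {n} → Graph n → Graph n → Set
SameAdjacency {n} G G′ = ∀ (x y : Fin n) → adj G x y ≡ adj G′ x y

filterᵇ-cong : ∀ {A : Set} {p q : A → Bool} → (∀ x → p x ≡ q x) → ∀ xs → filterᵇ p xs ≡ filterᵇ q xs
filterᵇ-cong {p = p} {q} p≗q =
  filter-≐ (T? ∘ p) (T? ∘ q) ((λ {x} → subst T (p≗q x)) , (λ {x} → subst T (sym (p≗q x))))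

module _ {n} {G G′ : Graph n} (same : SameAdjacency G G′) where

  closedPathᵇ-cong : ∀ {m} f (xs : Vec (Fin n) m) → closedPathᵇ G f xs ≡ closedPathᵇ G′ f xs
  closedPathᵇ-cong f []           = refl
  closedPathᵇ-cong f (x ∷ [])     = same x f
  closedPathᵇ-cong f (x ∷ y ∷ ys) = cong₂ _∧_ (same x y) (closedPathᵇ-cong f (y ∷ ys))

  isCycleᵇ-cong : ∀ {m} (xs : Vec (Fin n) m) → isCycleᵇ G xs ≡ isCycleᵇ G′ xs
  isCycleᵇ-cong     []       = refl
  isCycleᵇ-cong {m} (x ∷ xs) = cong (λ b → (3 ≤ᵇ m) ∧ distinctᵇ (x ∷ xs) ∧ b) (closedPathᵇ-cong x (x ∷ xs))

  IsVGR-resp : ∀ {k g lam} → IsVGR G k g lam → IsVGR G′ k g lam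
  IsVGR-resp {g = g} (regular , ((xs , cycle) , noShortCycle) , perVertex) =
    (λ v → trans (sym (cong length (filterᵇ-cong (same v) (allFin n)))) (regular v)) ,
    ((xs , trans (sym (isCycleᵇ-cong xs)) cycle) ,
     (λ m m<g ys → trans (sym (isCycleᵇ-cong ys)) (noShortCycle m m<g ys))) ,
    (λ v → trans (sym (cong length (filterᵇ-cong (λ ys → cong (startsAtᵇ v ys ∧_) (isCycleᵇ-cong ys)) (allVecs n g))))
                 (perVertex v))

module _ {m : ℕ} (P : Graph m → Set) (P? : ∀ G → Dec (P G))
         (P-resp : ∀ {G G′} → SameAdjacency G G′ → P G → P G′) where

  private
    -- A graph on Fin m is coded by the subset of Fin (m * m) ≅ Fin m × Fin m of its adjacent pairs.
    adjOf : Subset (m * m) → Fin m → Fin m → Bool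
    adjOf s x y = Vec.lookup s (combine x y)

    Good : Subset (m * m) → Set
    Good s = Σ (∀ x y → adjOf s x y ≡ adjOf s y x) λ sym → Σ (∀ x → adjOf s x x ≡ false) λ irr →
             P (record { adj = adjOf s ; sym = sym ; irrefl = irr })

    good? : ∀ s → Dec (Good s)
    good? s with all? (λ x → all? λ y → adjOf s x y Bool.≟ adjOf s y x) | all? (λ x → adjOf s x x Bool.≟ false)
    ... | yes sym | yes irr = map′ (λ p → sym , irr , p) (λ { (_ , _ , p) → P-resp (λ _ _ → refl) p }) (P? _)
    ... | no ¬sym | _       = no (¬sym ∘ proj₁)
    ... | yes _   | no ¬irr = no (¬irr ∘ proj₁ ∘ proj₂)

    subsetOf : Graph m → Subset (m * m)
    subsetOf G = tabulate (uncurry (adj G) ∘ remQuot m)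

    adjOf-subsetOf : ∀ G x y → adjOf (subsetOf G) x y ≡ adj G x y
    adjOf-subsetOf G x y = trans (lookup∘tabulate _ (combine x y)) (cong (uncurry (adj G)) (remQuot-combine x y))

    subsetOf-good : ∀ G → P G → Good (subsetOf G)
    subsetOf-good G p = sym′ , irr′ , P-resp (λ x y → sym (adjOf-subsetOf G x y)) p
      where
      sym′ : ∀ x y → adjOf (subsetOf G) x y ≡ adjOf (subsetOf G) y x
      sym′ x y = trans (adjOf-subsetOf G x y) (trans (Graph.sym G x y) (sym (adjOf-subsetOf G y x)))
      irr′ : ∀ x → adjOf (subsetOf G) x x ≡ false
      irr′ x = trans (adjOf-subsetOf G x x) (Graph.irrefl G x)

  ∃Graph? : Dec (Σ (Graph m) P)
  ∃Graph? = map′ (λ { (s , sym , irr , p) → record { adj = adjOf s ; sym = sym ; irrefl = irr } , p })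
                 (λ { (G , p) → subsetOf G , subsetOf-good G p })
                 (anySubset? good?)

∃VGR? : ∀ m k g lam → Dec (Σ (Graph m) λ G → IsVGR G k g lam)
∃VGR? m k g lam = ∃Graph? _ (λ G → IsVGR? G k g lam) (λ same → IsVGR-resp same {k} {g} {lam})

module _ {P : ℕ → Set} (P? : ∀ m → Dec (P m)) where

  private
    search : ∀ N → (Σ ℕ λ m → m ≤ N × P m × (∀ j → P j → m ≤ j)) ⊎ (∀ j → j ≤ N → ¬ P j)
    search zero with P? zero
    ... | yes p = inj₁ (zero , z≤n , p , λ _ _ → z≤n)
    ... | no ¬p = inj₂ λ { zero z≤n → ¬p }
    search (suc N) with search N
    ... | inj₁ (m , m≤N , p , least) = inj₁ (m , m≤n⇒m≤1+n m≤N , p , least)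
    ... | inj₂ none with P? (suc N)
    ...   | yes p = inj₁ (suc N , ≤-refl , p , λ j pj → ≰⇒> (λ j≤N → none j j≤N pj))
    ...   | no ¬p = inj₂ λ j j≤1+N →
      [ (λ j<1+N → none j (≤-pred j<1+N)) , (λ { refl → ¬p }) ]′ (m≤n⇒m<n∨m≡n j≤1+N)

  leastWitness : ∀ {N} → P N → Σ ℕ λ m → m ≤ N × P m × (∀ j → P j → m ≤ j)
  leastWitness {N} pN with search N
  ... | inj₁ least = least
  ... | inj₂ none  = contradiction pN (none N ≤-refl)

theorem6 : ∀ (n k h lam : ℕ) (G : Graph n) → k ≥ 3 → IsVGR G k (2 * h + 1) lam →
    Σ ℕ (λ m → IsMinVGROrder k (2 * h + 1) lam m × m ≤ n × vgrBound k h lam ℤ.≤ ℤ.+ m)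
theorem6 n k h lam G k≥3 vgr with leastWitness (λ m → ∃VGR? m k (2 * h + 1) lam) (G , vgr)
... | m , m≤n , (G′ , vgr′) , least =
  m , ((G′ , vgr′) , λ m′ G″ vgr″ → least m′ (G″ , vgr″)) , m≤n ,
  vgr⇒vgrBound≤order k h lam G′ k≥3 vgr′
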